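{- Let $\mathcal{A}$ be a set, $\sim$ a reflexive symmetric binary relation on $\mathcal{A}$, $I$ an index set, $(\mathcal{A}_i)_{i\in I}$ a family of non-empty subsets of $\mathcal{A}$ with $\mathcal{A}=\bigcup_{i\in I}\mathcal{A}_i$, and $|\cdot|\colon I\to\mathbb{N}_0$ a function. If the family $(\mathcal{A}_i)_{i\in I}$ thinly splinters with respect to $\sim$, then there is a set $N\subseteq\mathcal{A}$ which meets every $\mathcal{A}_i$ and is nested, i.e. $n_1\sim n_2$ for all $n_1,n_2\in N$. Moreover, the set $N=N((\mathcal{A}_i)_{i\in I})$ can be chosen invariant under isomorphisms: if $\phi$ is an isomorphism between $(\mathcal{A},\sim)$ and $(\mathcal{A}',\sim')$ (a bijection $\phi\colon\mathcal{A}\to\mathcal{A}'$ with $a\sim b\iff \phi(a)\sim'\phi(b)$), then $N((\phi(\mathcal{A}_i))_{i\in I})=\phi(N((\mathcal{A}_i)_{i\in I}))$, where the family $(\phi(\mathcal{A}_i))_{i\in I}$ carries the same function $|\cdot|$ on $I$.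
   Context: Two elements $a,b\in\mathcal{A}$ are called nested if $a\sim b$, and cross otherwise. An element $c\in\mathcal{A}$ is a corner of $a,b\in\mathcal{A}$ if every element of $\mathcal{A}$ crossing $c$ also crosses $a$ or $b$ (a corner need not itself be nested with $a$ or $b$). For $a\in\mathcal{A}$ and $k\in\mathbb{N}_0$, the $k$-crossing number of $a$ is the number (a natural number or $\infty$) of elements of $\mathcal{A}$ that cross $a$ and lie in some $\mathcal{A}_i$ with $|i|=k$. The family $(\mathcal{A}_i)_{i\in I}$ thinly splinters if: (1) for every $i\in I$, all elements of $\mathcal{A}_i$ have finite $k$-crossing number for all $k\le|i|$; (2) if $a_i\in\mathcal{A}_i$ and $a_j\in\mathcal{A}_j$ cross and $|i|<|j|$, then $\mathcal{A}_j$ contains some corner of $a_i$ and $a_j$ that is nested with $a_i$; (3) if $a_i\in\mathcal{A}_i$ and $a_j\in\mathcal{A}_j$ cross and $|i|=|j|=k$, then either $\mathcal{A}_i$ contains a corner of $a_i$ and $a_j$ with strictly lower $k$-crossing number than $a_i$, or $\mathcal{A}_j$ contains a corner of $a_i$ and $a_j$ with strictly lower $k$-crossing number than $a_j$. -}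

module Defs where

open import Level using (0ℓ)
open import Data.Nat using (ℕ; _≤_; _<_)
open import Data.Fin using (Fin)
open import Data.Product using (Σ; ∃; ∃₂; _×_; _,_)
open import Data.Sum using (_⊎_)
open import Relation.Nullary using (¬_)
open import Relation.Unary using (Pred)
open import Relation.Binary using (Rel; Reflexive; Symmetric)
open import Relation.Binary.PropositionalEquality using (_≡_)
open import Function.Definitions using (Injective)
open import Function.Bundles using (_↔_; Inverse; _⇔_)

module Splinter {I A : Set} (∣_∣ : I → ℕ) (_∼_ : Rel A 0ℓ) (𝒜 : I → Pred A 0ℓ) where

  Crosses : A → A → Set
  Crosses a b = ¬ (a ∼ b)

  Corner : A → A → A → Set
  Corner c a b = ∀ d → Crosses d c → Crosses d a ⊎ Crosses d b

  CrossSet : A → ℕ → Pred A 0ℓ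
  CrossSet a k b = Crosses b a × ∃ λ i → ∣ i ∣ ≡ k × 𝒜 i b

  -- P has exactly n elements (counted as elements, not as proofs):
  -- an injective enumeration Fin n → A whose image is exactly P
  HasCard : Pred A 0ℓ → ℕ → Set
  HasCard P n = Σ (Fin n → A) λ f →
    Injective _≡_ _≡_ f × (∀ j → P (f j)) × (∀ b → P b → ∃ λ j → f j ≡ b)

  CrossNum : A → ℕ → ℕ → Set
  CrossNum a k n = HasCard (CrossSet a k) n

  LowerCN : ℕ → A → A → Set
  LowerCN k c a = ∃₂ λ m n → CrossNum c k m × CrossNum a k n × m < n

  ThinlySplinters : Set
  ThinlySplinters =
      (∀ i a → 𝒜 i a → ∀ k → k ≤ ∣ i ∣ → ∃ λ n → CrossNum a k n)
    × (∀ i j a b → 𝒜 i a → 𝒜 j b → Crosses a b → ∣ i ∣ < ∣ j ∣ →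
         ∃ λ c → 𝒜 j c × Corner c a b × (c ∼ a))
    × (∀ i j a b → 𝒜 i a → 𝒜 j b → Crosses a b → ∣ i ∣ ≡ ∣ j ∣ →
           (∃ λ c → 𝒜 i c × Corner c a b × LowerCN ∣ i ∣ c a)
         ⊎ (∃ λ c → 𝒜 j c × Corner c a b × LowerCN ∣ j ∣ c b))

  Hyps : Set
  Hyps = Reflexive _∼_ × Symmetric _∼_
       × (∀ i → ∃ λ a → 𝒜 i a)
       × (∀ a → ∃ λ i → 𝒜 i a)
       × ThinlySplinters

  Nested : Pred A 0ℓ → Set
  Nested N = ∀ x y → N x → N y → x ∼ y

  MeetsAll : Pred A 0ℓ → Set
  MeetsAll N = ∀ i → ∃ λ a → N a × 𝒜 i a

Image : {A B : Set} → (A → B) → Pred A 0ℓ → Pred B 0ℓ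
Image f P y = ∃ λ a → P a × f a ≡ y

NChoice : Set → Set₁
NChoice I = (A : Set) → Rel A 0ℓ → (I → Pred A 0ℓ) → Pred A 0ℓ

IsIso : {A A' : Set} → Rel A 0ℓ → Rel A' 0ℓ → A ↔ A' → Set
IsIso _∼_ _∼'_ φ = ∀ a b → (a ∼ b) ⇔ (Inverse.to φ a ∼' Inverse.to φ b)

_≐_ : {A : Set} → Pred A 0ℓ → Pred A 0ℓ → Set
P ≐ Q = ∀ x → P x ⇔ Q x

-- Build N level by level, without making any choices. At level l, an element b of
-- some 𝒜 j with ∣ j ∣ ≡ l is a candidate if it is nested with everything chosen at lower levels,
-- and it is chosen if no candidate of 𝒜 j has a strictly lower l-crossing number. Chosen elements
-- of different levels are nested by construction, and two crossing ones of the same level would,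
-- by condition (3), admit a corner that is again a candidate with lower crossing number. Every 𝒜 j
-- has a candidate: start anywhere in 𝒜 j; the finitely many lower chosen elements crossing it
-- (condition (1)) can be removed one at a time by passing to the corner of condition (2). A
-- candidate of least crossing number is then chosen. Since N is defined from (∼, 𝒜) alone, it is
-- transported by every isomorphism.
module Submission where

open import Defs
open import Level using (0ℓ)
open import Axiom.ExcludedMiddle using (ExcludedMiddle)
open import Axiom.DoubleNegationElimination using (em⇒dne)
open import Data.Nat using (ℕ; zero; suc; _≤_; _<_)
open import Data.Nat.Properties using (≤-refl; ≤-antisym; <⇒≤; n<1+n; m<n⇒m<1+n; m<1+n⇒m<n∨m≡n; <-cmp)
open import Data.Nat.Induction using (<-wellFounded)
open import Induction.WellFounded using (Acc; acc)
open import Data.Fin using (Fin)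
open import Data.Fin.Properties using (injective⇒≤)
open import Data.Product using (Σ; ∃; _×_; _,_; proj₁; proj₂)
open import Data.Product.Function.NonDependent.Propositional using (_×-⇔_)
open import Data.Product.Function.Dependent.Propositional using (Σ-⇔)
open import Data.Sum using (_⊎_; inj₁; inj₂; swap)
open import Data.Sum.Function.Propositional using (_⊎-⇔_)
open import Data.Empty using (⊥; ⊥-elim)
open import Data.List using (List; []; _++_; length; tabulate; filter)
open import Data.List.Properties using (filter-notAll)
open import Data.List.Membership.Propositional using (_∈_)
open import Data.List.Membership.Propositional.Properties using (∈-++⁺ˡ; ∈-++⁺ʳ; ∈-tabulate⁺; ∈-filter⁺)
import Data.List.Relation.Unary.Any as Any
open import Relation.Nullary using (¬_; Dec; yes; no)
open import Relation.Unary using (Pred)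
open import Relation.Binary using (Rel; Symmetric; tri<; tri≈; tri>)
open import Relation.Binary.PropositionalEquality using (_≡_; refl; sym; trans; cong; subst)
open import Function.Bundles using (_↔_; Inverse; _⇔_; mk⇔; Equivalence; Injection)
open import Function.Properties.Inverse using (↔⇒↣; ↔-sym)
open import Function.Construct.Identity using (⇔-id; ↠-id)
open import Function.Construct.Composition using (_⇔-∘_)
open import Function.Construct.Symmetry using (⇔-sym)
open import Function.Related.TypeIsomorphisms using (→-cong-⇔; ¬-cong-⇔)

least-witness : ExcludedMiddle 0ℓ → {P : Pred ℕ 0ℓ} {n : ℕ} →
                P n → ∃ λ m → P m × (∀ {k} → k < m → ¬ P k)
least-witness em {P} {n} = go n (<-wellFounded n)
  where
    go : ∀ n → Acc _<_ n → P n → ∃ λ m → P m × (∀ {k} → k < m → ¬ P k)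
    go n (acc smaller) pn with em {∃ λ k → k < n × P k}
    ... | yes (k , k<n , pk) = go k (smaller k<n) pk
    ... | no none            = n , pn , λ k<n pk → none (_ , k<n , pk)

∃-⇔ : {X : Set} {P Q : Pred X 0ℓ} → (∀ x → P x ⇔ Q x) → ∃ P ⇔ ∃ Q
∃-⇔ P⇔Q = Σ-⇔ (↠-id _) (λ {x} → P⇔Q x)

module Construction {I : Set} (∣_∣ : I → ℕ) {A : Set} (_∼_ : Rel A 0ℓ) (𝒜 : I → Pred A 0ℓ) where
  open Splinter ∣_∣ _∼_ 𝒜

  HasCard-≤ : ∀ {P : Pred A 0ℓ} {m n} → HasCard P m → HasCard P n → m ≤ n
  HasCard-≤ {m = m} {n} (f , f-inj , f-in , _) (g , _ , _ , g-onto) = injective⇒≤ {f = g⁻¹∘f} g⁻¹∘f-inj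
    where
      g⁻¹∘f : Fin m → Fin n
      g⁻¹∘f x = proj₁ (g-onto (f x) (f-in x))

      g∘g⁻¹∘f : ∀ x → g (g⁻¹∘f x) ≡ f x
      g∘g⁻¹∘f x = proj₂ (g-onto (f x) (f-in x))

      g⁻¹∘f-inj : ∀ {x y} → g⁻¹∘f x ≡ g⁻¹∘f y → x ≡ y
      g⁻¹∘f-inj {x} {y} e = f-inj (trans (sym (g∘g⁻¹∘f x)) (trans (cong g e) (g∘g⁻¹∘f y)))

  HasCard-unique : ∀ {P : Pred A 0ℓ} {m n} → HasCard P m → HasCard P n → m ≡ n
  HasCard-unique p q = ≤-antisym (HasCard-≤ p q) (HasCard-≤ q p)

  finite-family-listed : ∀ {P : ℕ → Pred A 0ℓ} l → (∀ {k} → k < l → ∃ (HasCard (P k))) →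
            Σ (List A) λ L → ∀ {k a} → k < l → P k a → a ∈ L
  finite-family-listed zero    _      = [] , λ ()
  finite-family-listed (suc l) finite
    with finite-family-listed l (λ k<l → finite (m<n⇒m<1+n k<l)) | finite (n<1+n l)
  ... | L , listed | _ , f , _ , _ , f-onto = L ++ tabulate f , listed′
    where
      listed′ : ∀ {k a} → k < suc l → _ → a ∈ L ++ tabulate f
      listed′ k<1+l pa with m<1+n⇒m<n∨m≡n k<1+l
      ... | inj₁ k<l  = ∈-++⁺ˡ (listed k<l pa)
      ... | inj₂ refl with f-onto _ pa
      ...   | x , refl = ∈-++⁺ʳ L (∈-tabulate⁺ x)

  mutual
    Below : ℕ → Pred A 0ℓ
    Below zero    _ = ⊥
    Below (suc l) a = Below l a ⊎ Chosen l a

    Candidate : ℕ → I → Pred A 0ℓ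
    Candidate l j b = 𝒜 j b × ∣ j ∣ ≡ l × (∀ a → Below l a → a ∼ b)

    Chosen : ℕ → Pred A 0ℓ
    Chosen l b = ∃ λ j → Candidate l j b × (∀ c → Candidate l j c → ¬ LowerCN l c b)

  N : Pred A 0ℓ
  N a = ∃ λ l → Chosen l a

  Chosen⇒nested-below : ∀ {l b} → Chosen l b → ∀ a → Below l a → a ∼ b
  Chosen⇒nested-below (_ , (_ , _ , below∼b) , _) = below∼b

  Chosen⇒Below : ∀ {k l a} → k < l → Chosen k a → Below l a
  Chosen⇒Below {k} {suc l} k<1+l chosen with m<1+n⇒m<n∨m≡n k<1+l
  ... | inj₁ k<l  = inj₁ (Chosen⇒Below k<l chosen)
  ... | inj₂ refl = inj₂ chosen

  Below⇒Chosen : ∀ {l a} → Below l a → ∃ λ k → k < l × Chosen k a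
  Below⇒Chosen {suc l} (inj₁ below) with Below⇒Chosen below
  ... | k , k<l , chosen = k , m<n⇒m<1+n k<l , chosen
  Below⇒Chosen {suc l} (inj₂ chosen) = l , n<1+n l , chosen

  Below⇒N : ∀ {l a} → Below l a → N a
  Below⇒N below with Below⇒Chosen below
  ... | k , _ , chosen = k , chosen

  Corner-swap : ∀ {c a b} → Corner c a b → Corner c b a
  Corner-swap corner d d-crosses-c = swap (corner d d-crosses-c)

  ListsCrossersBelow : ℕ → A → List A → Set
  ListsCrossersBelow l b L = ∀ a → Below l a → Crosses a b → a ∈ L

  module _ (em : ExcludedMiddle 0ℓ) (hyps : Hyps) where
    ∼-sym : Symmetric _∼_
    ∼-sym = proj₁ (proj₂ hyps)

    nonempty : ∀ i → ∃ (𝒜 i)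
    nonempty = proj₁ (proj₂ (proj₂ hyps))

    finite-crossing : ∀ i a → 𝒜 i a → ∀ k → k ≤ ∣ i ∣ → ∃ (CrossNum a k)
    finite-crossing = proj₁ (proj₂ (proj₂ (proj₂ (proj₂ hyps))))

    corner-lower-level : ∀ i j a b → 𝒜 i a → 𝒜 j b → Crosses a b → ∣ i ∣ < ∣ j ∣ →
                         ∃ λ c → 𝒜 j c × Corner c a b × (c ∼ a)
    corner-lower-level = proj₁ (proj₂ (proj₂ (proj₂ (proj₂ (proj₂ hyps)))))

    corner-equal-level : ∀ i j a b → 𝒜 i a → 𝒜 j b → Crosses a b → ∣ i ∣ ≡ ∣ j ∣ →
                           (∃ λ c → 𝒜 i c × Corner c a b × LowerCN ∣ i ∣ c a)
                         ⊎ (∃ λ c → 𝒜 j c × Corner c a b × LowerCN ∣ j ∣ c b)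
    corner-equal-level = proj₂ (proj₂ (proj₂ (proj₂ (proj₂ (proj₂ hyps)))))

    dne : ∀ {P : Set} → ¬ ¬ P → P
    dne = em⇒dne em

    _≢?_ : (x a : A) → Dec (¬ x ≡ a)
    x ≢? a = em

    Candidate-corner : ∀ {l j a b c} → Candidate l j a → (∀ d → Below l d → d ∼ b) →
                       𝒜 j c → Corner c a b → Candidate l j c
    Candidate-corner (_ , level , below∼a) below∼b c∈𝒜 corner =
      c∈𝒜 , level , λ d below → dne λ d-crosses-c → case (corner d d-crosses-c) below
      where
        case : ∀ {d} → Crosses d _ ⊎ Crosses d _ → Below _ d → ⊥
        case (inj₁ d-crosses-a) below = d-crosses-a (below∼a _ below)
        case (inj₂ d-crosses-b) below = d-crosses-b (below∼b _ below)

    Chosen-nested-level : ∀ {l a b} → Chosen l a → Chosen l b → a ∼ b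
    Chosen-nested-level {a = a} {b} (i , cand-a@(a∈𝒜 , level-i , below∼a) , minimal-a)
                                (j , cand-b@(b∈𝒜 , level-j , below∼b) , minimal-b) =
      dne λ a-crosses-b →
        case (corner-equal-level i j a b a∈𝒜 b∈𝒜 a-crosses-b (trans level-i (sym level-j)))
      where
        case : _ → ⊥
        case (inj₁ (c , c∈𝒜 , corner , lower)) =
          minimal-a c (Candidate-corner cand-a below∼b c∈𝒜 corner)
                      (subst (λ k → LowerCN k c a) level-i lower)
        case (inj₂ (c , c∈𝒜 , corner , lower)) =
          minimal-b c (Candidate-corner cand-b below∼a c∈𝒜 (Corner-swap corner))
                      (subst (λ k → LowerCN k c b) level-j lower)

    Chosen-nested : ∀ {k l a b} → Chosen k a → Chosen l b → a ∼ b
    Chosen-nested {k} {l} chosen-a chosen-b with <-cmp k l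
    ... | tri< k<l _ _  = Chosen⇒nested-below chosen-b _ (Chosen⇒Below k<l chosen-a)
    ... | tri≈ _ refl _ = Chosen-nested-level chosen-a chosen-b
    ... | tri> _ _ l<k  = ∼-sym (Chosen⇒nested-below chosen-a _ (Chosen⇒Below l<k chosen-b))

    N-nested : Nested N
    N-nested _ _ (_ , chosen-a) (_ , chosen-b) = Chosen-nested chosen-a chosen-b

    crossers-below-listed : ∀ {j b} → 𝒜 j b → ∃ (ListsCrossersBelow ∣ j ∣ b)
    crossers-below-listed {j} {b} b∈𝒜
      with finite-family-listed {λ k → CrossSet b k} ∣ j ∣ (λ k<l → finite-crossing j b b∈𝒜 _ (<⇒≤ k<l))
    ... | L , listed = L , λ a below a-crosses-b → lists (Below⇒Chosen below) a-crosses-b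
      where
        lists : ∀ {a} → ∃ (λ k → k < ∣ j ∣ × Chosen k a) → Crosses a b → a ∈ L
        lists (k , k<l , (i , (a∈𝒜 , level , _) , _)) a-crosses-b =
          listed k<l (a-crosses-b , i , level , a∈𝒜)

    -- Passing to a corner c ∼ a of a lower chosen a and b removes a from the crossers:
    -- nothing chosen below crosses a, so whatever crosses c already crossed b.
    drop-crosser : ∀ {l a b c L} → ListsCrossersBelow l b L → Below l a → Corner c a b → c ∼ a →
                   ListsCrossersBelow l c (filter (_≢? a) L)
    drop-crosser listed below-a corner c∼a d below-d d-crosses-c with corner d d-crosses-c
    ... | inj₁ d-crosses-a = ⊥-elim (d-crosses-a (N-nested _ _ (Below⇒N below-d) (Below⇒N below-a)))
    ... | inj₂ d-crosses-b = ∈-filter⁺ (_≢? _) (listed d below-d d-crosses-b)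
                                λ { refl → d-crosses-c (∼-sym c∼a) }

    descend : ∀ {j b} L → Acc _<_ (length L) → 𝒜 j b → ListsCrossersBelow ∣ j ∣ b L →
              ∃ (Candidate ∣ j ∣ j)
    descend {j} {b} L (acc shorter) b∈𝒜 listed with em {∃ λ a → Below ∣ j ∣ a × Crosses a b}
    ... | no none = b , b∈𝒜 , refl , λ a below → dne λ a-crosses-b → none (a , below , a-crosses-b)
    ... | yes (a , below , a-crosses-b) with Below⇒Chosen below
    ...   | k , k<l , (i , (a∈𝒜 , level , _) , _)
          with corner-lower-level i j a b a∈𝒜 b∈𝒜 a-crosses-b (subst (_< ∣ j ∣) (sym level) k<l)
    ...     | c , c∈𝒜 , corner , c∼a =
      descend _ (shorter (filter-notAll (_≢? a) L a∉filtered)) c∈𝒜 (drop-crosser listed below corner c∼a)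
      where
        a∉filtered : Any.Any (λ x → ¬ ¬ x ≡ a) L
        a∉filtered = Any.map (λ { refl a≢a → a≢a refl }) (listed a below a-crosses-b)

    Candidate-exists : ∀ j → ∃ (Candidate ∣ j ∣ j)
    Candidate-exists j with nonempty j
    ... | b , b∈𝒜 with crossers-below-listed b∈𝒜
    ...   | L , listed = descend L (<-wellFounded (length L)) b∈𝒜 listed

    Chosen-exists : ∀ j → ∃ λ b → Chosen ∣ j ∣ b × 𝒜 j b
    Chosen-exists j with Candidate-exists j
    ... | b₀ , cand₀ with finite-crossing j b₀ (proj₁ cand₀) ∣ j ∣ ≤-refl
    ...   | n₀ , cn₀
          with least-witness em {λ n → ∃ λ b → Candidate (∣ j ∣) j b × CrossNum b (∣ j ∣) n} (b₀ , cand₀ , cn₀)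
    ...     | m , (b , cand , cn) , least = b , (j , cand , minimal) , proj₁ cand
      where
        minimal : ∀ c → Candidate ∣ j ∣ j c → ¬ LowerCN ∣ j ∣ c b
        minimal c cand-c (m′ , n′ , cn-c , cn-b , m′<n′) =
          least (subst (m′ <_) (HasCard-unique cn-b cn) m′<n′) (c , cand-c , cn-c)

    N-meets-all : MeetsAll N
    N-meets-all j with Chosen-exists j
    ... | b , chosen , b∈𝒜 = b , (∣ j ∣ , chosen) , b∈𝒜

module Transport {I : Set} (∣_∣ : I → ℕ) {A A′ : Set} (_∼_ : Rel A 0ℓ) (_∼′_ : Rel A′ 0ℓ)
    (𝒜 : I → Pred A 0ℓ) (φ : A ↔ A′) (iso : IsIso _∼_ _∼′_ φ) where
  open Inverse φ using (to; from; strictlyInverseˡ; strictlyInverseʳ)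

  𝒜′ : I → Pred A′ 0ℓ
  𝒜′ i = Image to (𝒜 i)

  module S  = Construction ∣_∣ _∼_ 𝒜
  module S′ = Construction ∣_∣ _∼′_ 𝒜′
  module Sp  = Splinter ∣_∣ _∼_ 𝒜
  module Sp′ = Splinter ∣_∣ _∼′_ 𝒜′

  to-injective : ∀ {a b} → to a ≡ to b → a ≡ b
  to-injective = Injection.injective (↔⇒↣ φ)

  from-injective : ∀ {a′ b′} → from a′ ≡ from b′ → a′ ≡ b′
  from-injective = Injection.injective (↔⇒↣ (↔-sym φ))

  ∀-via-to : {Q : Pred A′ 0ℓ} → (∀ a → Q (to a)) → ∀ a′ → Q a′
  ∀-via-to {Q} q a′ = subst Q (strictlyInverseˡ a′) (q (from a′))

  ∀-transport : {P : Pred A 0ℓ} {P′ : Pred A′ 0ℓ} →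
                (∀ a → P a ⇔ P′ (to a)) → (∀ a → P a) ⇔ (∀ a′ → P′ a′)
  ∀-transport P⇔P′ = mk⇔
    (λ all → ∀-via-to λ a → Equivalence.to (P⇔P′ a) (all a))
    (λ all′ a → Equivalence.from (P⇔P′ a) (all′ (to a)))

  Image-to : (P : Pred A 0ℓ) (a : A) → P a ⇔ Image to P (to a)
  Image-to P a = mk⇔ (λ pa → a , pa , refl) (λ { (b , pb , e) → subst P (to-injective e) pb })

  Crosses-transport : ∀ a b → Sp.Crosses a b ⇔ Sp′.Crosses (to a) (to b)
  Crosses-transport a b = ¬-cong-⇔ (iso a b)

  CrossSet-transport : ∀ a k b → Sp.CrossSet a k b ⇔ Sp′.CrossSet (to a) k (to b)
  CrossSet-transport a k b = Crosses-transport b a ×-⇔ ∃-⇔ λ i → ⇔-id _ ×-⇔ Image-to (𝒜 i) b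

  HasCard-transport : {P : Pred A 0ℓ} {P′ : Pred A′ 0ℓ} → (∀ a → P a ⇔ P′ (to a)) →
                      ∀ n → Sp.HasCard P n ⇔ Sp′.HasCard P′ n
  HasCard-transport {P} {P′} P⇔P′ n = mk⇔ forth back
    where
      forth : Sp.HasCard P n → Sp′.HasCard P′ n
      forth (f , f-inj , f-in , f-onto) =
        (λ x → to (f x)) , (λ e → f-inj (to-injective e)) ,
        (λ x → Equivalence.to (P⇔P′ (f x)) (f-in x)) ,
        ∀-via-to λ a p′ → let (x , e) = f-onto a (Equivalence.from (P⇔P′ a) p′) in x , cong to e

      back : Sp′.HasCard P′ n → Sp.HasCard P n
      back (f , f-inj , f-in , f-onto) =
        (λ x → from (f x)) , (λ e → f-inj (from-injective e)) ,
        (λ x → Equivalence.from (P⇔P′ (from (f x))) (subst P′ (sym (strictlyInverseˡ (f x))) (f-in x))) ,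
        λ a pa → let (x , e) = f-onto (to a) (Equivalence.to (P⇔P′ a) pa)
                 in x , trans (cong from e) (strictlyInverseʳ a)

  LowerCN-transport : ∀ k c a → Sp.LowerCN k c a ⇔ Sp′.LowerCN k (to c) (to a)
  LowerCN-transport k c a = ∃-⇔ λ m → ∃-⇔ λ n →
    HasCard-transport (CrossSet-transport c k) m ×-⇔ HasCard-transport (CrossSet-transport a k) n ×-⇔ ⇔-id _

  mutual
    Below-transport : ∀ l a → S.Below l a ⇔ S′.Below l (to a)
    Below-transport zero    a = mk⇔ (λ ()) (λ ())
    Below-transport (suc l) a = Below-transport l a ⊎-⇔ Chosen-transport l a

    Candidate-transport : ∀ l j b → S.Candidate l j b ⇔ S′.Candidate l j (to b)
    Candidate-transport l j b = Image-to (𝒜 j) b ×-⇔ ⇔-id _ ×-⇔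
      ∀-transport λ a → →-cong-⇔ (Below-transport l a) (iso a b)

    Chosen-transport : ∀ l b → S.Chosen l b ⇔ S′.Chosen l (to b)
    Chosen-transport l b = ∃-⇔ λ j → Candidate-transport l j b ×-⇔
      ∀-transport λ c → →-cong-⇔ (Candidate-transport l j c) (¬-cong-⇔ (LowerCN-transport l c b))

  N-transport : S′.N ≐ Image to S.N
  N-transport = ∀-via-to λ a → Image-to S.N a ⇔-∘ ⇔-sym (∃-⇔ λ l → Chosen-transport l a)

theorem1p2 : ExcludedMiddle 0ℓ → (I : Set) (∣_∣ : I → ℕ) →
    Σ (NChoice I) λ N →
      ((A : Set) (_∼_ : Rel A 0ℓ) (𝒜 : I → Pred A 0ℓ) →
         Splinter.Hyps ∣_∣ _∼_ 𝒜 →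
         Splinter.Nested ∣_∣ _∼_ 𝒜 (N A _∼_ 𝒜) × Splinter.MeetsAll ∣_∣ _∼_ 𝒜 (N A _∼_ 𝒜))
      × ((A : Set) (_∼_ : Rel A 0ℓ) (𝒜 : I → Pred A 0ℓ) →
         Splinter.Hyps ∣_∣ _∼_ 𝒜 →
         (A' : Set) (_∼'_ : Rel A' 0ℓ) (φ : A ↔ A') → IsIso _∼_ _∼'_ φ →
         N A' _∼'_ (λ i → Image (Inverse.to φ) (𝒜 i)) ≐ Image (Inverse.to φ) (N A _∼_ 𝒜))
theorem1p2 em I ∣_∣ =
  (λ A _∼_ 𝒜 → Construction.N ∣_∣ _∼_ 𝒜)
  , (λ A _∼_ 𝒜 hyps → Construction.N-nested ∣_∣ _∼_ 𝒜 em hyps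
                     , Construction.N-meets-all ∣_∣ _∼_ 𝒜 em hyps)
  , (λ A _∼_ 𝒜 _ A′ _∼′_ φ iso → Transport.N-transport ∣_∣ _∼_ _∼′_ 𝒜 φ iso)
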